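{- Let $G=(V,E)$ be a graph, $k\ge1$, and let $S\subseteq V$ be such that every connected component of $G-S$ is a clique or a tree; let $V_{\mathrm{tree}}$ be the union of the vertex sets of the components of $G-S$ that are trees. If a vertex $v\in V_{\mathrm{ld}}\cap S$ has at least $2k+4$ neighbors in $V_{\mathrm{tree}}$, then $(G,k)$ is a yes-instance of \textsc{Cliques or Trees Vertex Deletion} if and only if $(G-v,k-1)$ is a yes-instance.
   Context: Graphs are undirected, without self-loops, possibly with multi-edges (parallel edges form a cycle). $N(v)$ is the neighbor set; $\rho(v)$ is the number of unordered pairs of neighbors of $v$ that are adjacent (parallel edges counted once). $V_{\mathrm{ld}}$ is the set of vertices $v$ with $|N(v)|>7k$ and $\rho(v)>|N(v)|(|N(v)|-1)/4$. A clique has exactly one edge between any two distinct vertices; a tree is connected and acyclic. \textsc{Cliques or Trees Vertex Deletion}: given $(G,k)$, decide whether there is $X\subseteq V$ with $|X|\le k$ such that every component of $G-X$ is a clique or a tree. -}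

module Defs where

open import Data.Nat using (ℕ; zero; suc; _+_; _*_; _∸_; _≤_; _<_; _<ᵇ_)
open import Data.Bool using (Bool; true; false; _∧_; if_then_else_)
open import Data.Fin using (Fin; toℕ; inject₁; fromℕ) renaming (zero to fzero; suc to fsuc)
open import Data.Fin.Subset using (Subset; _∈_; _∉_; _⊆_; ∣_∣; _─_; ⊤; ∁; ⁅_⁆)
open import Data.Vec using (tabulate)
open import Data.List using (List; map; length)
open import Data.Nat.ListAction using (sum)
open import Data.List.Relation.Unary.All using (All)
open import Data.List.Relation.Unary.Unique.Propositional using (Unique)
open import Data.Product using (Σ; _×_; ∃)
open import Data.Sum using (_⊎_)
open import Data.Empty using (⊥)
open import Data.List using () renaming (allFin to allFinL)
open import Function.Definitions using (Injective)
open import Relation.Binary.PropositionalEquality using (_≡_; _≢_)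
open import Relation.Nullary using (¬_)

-- A finite multigraph on vertex set Fin n: mult u w = number of parallel
-- edges between u and w (0 = non-adjacent).  Undirected, no self-loops.
record Graph (n : ℕ) : Set where
  field
    mult     : Fin n → Fin n → ℕ
    symm     : ∀ u w → mult u w ≡ mult w u
    loopless : ∀ u → mult u u ≡ 0
open Graph public

module _ {n : ℕ} (G : Graph n) where

  Adj : Fin n → Fin n → Set
  Adj u w = 0 < mult G u w

  adjᵇ : Fin n → Fin n → Bool
  adjᵇ u w = 0 <ᵇ mult G u w

  data Reach (W : Subset n) : Fin n → Fin n → Set where
    here : ∀ {u} → u ∈ W → Reach W u u
    step : ∀ {u w x} → u ∈ W → Adj u w → Reach W w x → Reach W u x

  InComp : Subset n → Fin n → Fin n → Set
  InComp W u x = Reach W u x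

  IsCliqueComp : Subset n → Fin n → Set
  IsCliqueComp W u = ∀ x y → InComp W u x → InComp W u y → x ≢ y → mult G x y ≡ 1

  -- A cycle of length m+3 in the component of u in G[W]
  -- (cycles of length 2 are parallel edges, handled separately).
  CycleIn : Subset n → Fin n → Set
  CycleIn W u = Σ ℕ λ m → Σ (Fin (3 + m) → Fin n) λ c →
      Injective _≡_ _≡_ c
    × (∀ i → InComp W u (c i))
    × (∀ (i : Fin (2 + m)) → Adj (c (inject₁ i)) (c (fsuc i)))
    × Adj (c (fromℕ (2 + m))) (c fzero)

  -- The component of u in G[W] is a tree (connected by construction, and
  -- acyclic: no parallel edges and no cycle of length ≥ 3).
  IsTreeComp : Subset n → Fin n → Set
  IsTreeComp W u = (∀ x y → InComp W u x → InComp W u y → mult G x y ≤ 1)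
                 × ¬ CycleIn W u

  AllCliqueOrTree : Subset n → Set
  AllCliqueOrTree W = ∀ u → u ∈ W → IsCliqueComp W u ⊎ IsTreeComp W u

  -- (G[U], k) is a yes-instance of Cliques or Trees Vertex Deletion
  YesInstance : Subset n → ℕ → Set
  YesInstance U k = ∃ λ (X : Subset n) → X ⊆ U × ∣ X ∣ ≤ k × AllCliqueOrTree (U ─ X)

  Nbr : Fin n → Subset n
  Nbr v = tabulate (λ u → adjᵇ v u)

  ρ : Fin n → ℕ
  ρ v = sum (map (λ a → sum (map (λ b →
          if (toℕ a <ᵇ toℕ b) ∧ adjᵇ v a ∧ adjᵇ v b ∧ adjᵇ a b then 1 else 0)
          (allFinL n))) (allFinL n))

  InVld : ℕ → Fin n → Set
  InVld k v = 7 * k < ∣ Nbr v ∣ × ∣ Nbr v ∣ * (∣ Nbr v ∣ ∸ 1) < 4 * ρ v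

  InVtree : Subset n → Fin n → Set
  InVtree S u = u ∉ S × IsTreeComp (∁ S) u

  NbrsInVtreeAtLeast : Subset n → Fin n → ℕ → Set
  NbrsInVtreeAtLeast S v d = Σ (List (Fin n)) λ us →
    d ≤ length us × Unique us × All (λ u → Adj v u × InVtree S u) us

{-# OPTIONS --safe #-}
-- Every solution X of (G, k) contains v.  Otherwise the component of v in G − X is a tree or a
-- clique.  A tree contains no triangle through v, so X meets every edge of G[N(v)]; charging each
-- such edge to an ordered pair in X × N(v) gives ρ(v) ≤ k·|N(v)|, whereas |N(v)| > 4k and
-- ρ(v) > |N(v)|(|N(v)| − 1)/4 force ρ(v) > k·|N(v)|.  In a clique, at least 3 of the 2k + 4
-- neighbours of v in V_tree survive in G − X and are pairwise adjacent: a triangle inside a tree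
-- component of G − S.  So X ↦ X − v and X′ ↦ X′ ∪ {v} translate between the two instances.
module Submission where

open import Defs
open import Data.Bool using (Bool; true; false; _∧_; if_then_else_; T)
open import Data.Bool.Properties using (T-≡)
open import Data.Empty using (⊥-elim)
open import Data.Fin using (Fin; zero; suc; toℕ; inject₁)
open import Data.Fin.Subset
  using (Subset; inside; outside; _∈_; _∉_; _⊆_; ∣_∣; _─_; _-_; _∪_; ⊤; ∁; ⁅_⁆)
open import Data.Fin.Subset.Properties
  using ( _∈?_; ∈⊤; drop-∷-⊆; ∣p∣≤∣x∷p∣; ∣⁅x⁆∣≡1; x∈⁅y⁆⇒x≡y; x∉p⇒x∈∁p
        ; x∈p∧x∉q⇒x∈p─q; x∈p∧x≢y⇒x∈p-y; x∈p⇒∣p-x∣<∣p∣)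
open import Data.List using (List; []; _∷_; length; map; filter; allFin; tabulate)
open import Data.List.Properties using (map-tabulate)
open import Data.List.Relation.Unary.All as All using (All; []; _∷_)
open import Data.List.Relation.Unary.All.Properties
  using (all-filter) renaming (filter⁺ to All-filter⁺)
open import Data.List.Relation.Unary.AllPairs using ([]; _∷_)
open import Data.List.Relation.Unary.Unique.Propositional using (Unique)
open import Data.List.Relation.Unary.Unique.Propositional.Properties
  using () renaming (filter⁺ to Unique-filter⁺)
open import Data.Nat using (ℕ; zero; suc; _+_; _*_; _∸_; _≤_; _<_; _<ᵇ_; z≤n; s≤s; z<s)
open import Data.Nat.ListAction using () renaming (sum to sumₗ)
open import Data.Nat.Properties
open import Algebra.Properties.CommutativeMonoid.Sum +-0-commutativeMonoid
  using (sum-syntax; ∑-comm; ∑-distrib-+; sum-cong-≗) renaming (sum to ∑)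
open import Algebra.Properties.Semiring.Sum +-*-semiring using (*-distribˡ-sum; *-distribʳ-sum)
open import Data.Product using (_×_; _,_; proj₂)
open import Data.Sum as Sum using (_⊎_; inj₁; inj₂)
open import Data.Unit using (tt)
open import Data.Vec using ([]; _∷_; here; there; lookup)
open import Data.Vec.Properties using ([]=⇒lookup; lookup∘tabulate)
open import Function using (_∘_; _⇔_; mk⇔; Equivalence)
open import Relation.Binary.PropositionalEquality
  using (_≡_; _≢_; refl; sym; trans; cong; cong₂; subst; ≢-sym; module ≡-Reasoning)
open import Relation.Nullary using (Dec; yes; no; ¬?)
open import Relation.Unary using (Pred; Decidable)
open import Relation.Unary.Properties using () renaming (∁? to ∁ᵘ?)

χ : Bool → ℕ
χ b = if b then 1 else 0

∑-mono-≤ : ∀ {n} {f g : Fin n → ℕ} → (∀ i → f i ≤ g i) → ∑ f ≤ ∑ g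
∑-mono-≤ {zero}  f≤g = z≤n
∑-mono-≤ {suc n} f≤g = +-mono-≤ (f≤g zero) (∑-mono-≤ (f≤g ∘ suc))

sumₗ-tabulate : ∀ {n} (f : Fin n → ℕ) → sumₗ (tabulate f) ≡ ∑ f
sumₗ-tabulate {zero}  f = refl
sumₗ-tabulate {suc n} f = cong (f zero +_) (sumₗ-tabulate (f ∘ suc))

sumₗ-map-allFin : ∀ {n} (f : Fin n → ℕ) → sumₗ (map f (allFin n)) ≡ ∑ f
sumₗ-map-allFin f = trans (cong sumₗ (map-tabulate (λ i → i) f)) (sumₗ-tabulate f)

sumₗ-map-allFin² : ∀ {m n} (f : Fin m → Fin n → ℕ) →
  sumₗ (map (λ i → sumₗ (map (f i) (allFin n))) (allFin m)) ≡ ∑[ i < m ] ∑[ j < n ] f i j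
sumₗ-map-allFin² {n = n} f =
  trans (sumₗ-map-allFin (λ i → sumₗ (map (f i) (allFin n)))) (sum-cong-≗ (sumₗ-map-allFin ∘ f))

∣p∣≡∑χ : ∀ {n} (p : Subset n) → ∣ p ∣ ≡ ∑ (χ ∘ lookup p)
∣p∣≡∑χ []            = refl
∣p∣≡∑χ (inside  ∷ p) = cong suc (∣p∣≡∑χ p)
∣p∣≡∑χ (outside ∷ p) = ∣p∣≡∑χ p

∑∑-*≡∑*∑ : ∀ {m n} (f : Fin m → ℕ) (g : Fin n → ℕ) →
  ∑[ i < m ] ∑[ j < n ] (f i * g j) ≡ ∑ f * ∑ g
∑∑-*≡∑*∑ {m} {n} f g = begin
  ∑[ i < m ] ∑[ j < n ] (f i * g j) ≡⟨ sum-cong-≗ (λ i → *-distribˡ-sum (f i) g) ⟨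
  ∑[ i < m ] (f i * ∑ g)            ≡⟨ *-distribʳ-sum (∑ g) f ⟨
  ∑ f * ∑ g                         ∎
  where open ≡-Reasoning

∑∑-distrib-+ : ∀ {m n} (f g : Fin m → Fin n → ℕ) →
  ∑[ i < m ] ∑[ j < n ] (f i j + g i j) ≡ ∑[ i < m ] ∑[ j < n ] f i j + ∑[ i < m ] ∑[ j < n ] g i j
∑∑-distrib-+ {n = n} f g = trans (sum-cong-≗ (λ i → ∑-distrib-+ (f i) (g i)))
  (∑-distrib-+ (λ i → ∑[ j < n ] f i j) (λ i → ∑[ j < n ] g i j))

χ<ᵇ+χ>ᵇ≤1 : ∀ m n → χ (m <ᵇ n) + χ (n <ᵇ m) ≤ 1
χ<ᵇ+χ>ᵇ≤1 zero    zero    = z≤n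
χ<ᵇ+χ>ᵇ≤1 zero    (suc n) = ≤-refl
χ<ᵇ+χ>ᵇ≤1 (suc m) zero    = ≤-refl
χ<ᵇ+χ>ᵇ≤1 (suc m) (suc n) = χ<ᵇ+χ>ᵇ≤1 m n

χ< : ∀ {n} → Fin n → Fin n → ℕ
χ< i j = χ (toℕ i <ᵇ toℕ j)

∑∑-χ<-symmetrised≤∑∑ : ∀ {n} (f : Fin n → Fin n → ℕ) →
  ∑[ i < n ] ∑[ j < n ] (χ< i j * (f i j + f j i)) ≤ ∑[ i < n ] ∑[ j < n ] f i j
∑∑-χ<-symmetrised≤∑∑ {n} f = begin
  ∑[ i < n ] ∑[ j < n ] (χ< i j * (f i j + f j i))
    ≡⟨ sum-cong-≗ (λ i → sum-cong-≗ (λ j → *-distribˡ-+ (χ< i j) (f i j) (f j i))) ⟩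
  ∑[ i < n ] ∑[ j < n ] (χ< i j * f i j + χ< i j * f j i)
    ≡⟨ ∑∑-distrib-+ (λ i j → χ< i j * f i j) (λ i j → χ< i j * f j i) ⟩
  ∑[ i < n ] ∑[ j < n ] (χ< i j * f i j) + ∑[ i < n ] ∑[ j < n ] (χ< i j * f j i)
    ≡⟨ cong (∑[ i < n ] ∑[ j < n ] (χ< i j * f i j) +_) (∑-comm (λ i j → χ< i j * f j i)) ⟩
  ∑[ i < n ] ∑[ j < n ] (χ< i j * f i j) + ∑[ i < n ] ∑[ j < n ] (χ< j i * f i j)
    ≡⟨ ∑∑-distrib-+ (λ i j → χ< i j * f i j) (λ i j → χ< j i * f i j) ⟨
  ∑[ i < n ] ∑[ j < n ] (χ< i j * f i j + χ< j i * f i j)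
    ≤⟨ ∑-mono-≤ (λ i → ∑-mono-≤ (λ j → at-most-one-order i j)) ⟩
  ∑[ i < n ] ∑[ j < n ] f i j
    ∎
  where
  open ≤-Reasoning
  at-most-one-order : ∀ i j → χ< i j * f i j + χ< j i * f i j ≤ f i j
  at-most-one-order i j = begin
    χ< i j * f i j + χ< j i * f i j ≡⟨ *-distribʳ-+ (f i j) (χ< i j) (χ< j i) ⟨
    (χ< i j + χ< j i) * f i j       ≤⟨ *-monoˡ-≤ (f i j) (χ<ᵇ+χ>ᵇ≤1 (toℕ i) (toℕ j)) ⟩
    1 * f i j                       ≡⟨ *-identityˡ (f i j) ⟩
    f i j                           ∎

χ-∧-cover : ∀ l a b e x y → (T a → T b → T e → T x ⊎ T y) →
  χ (l ∧ a ∧ b ∧ e) ≤ χ l * (χ x * χ b + χ y * χ a)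
χ-∧-cover false _     _     _     _     _     _     = z≤n
χ-∧-cover true  false _     _     _     _     _     = z≤n
χ-∧-cover true  true  false _     _     _     _     = z≤n
χ-∧-cover true  true  true  false _     _     _     = z≤n
χ-∧-cover true  true  true  true  true  _     _     = s≤s z≤n
χ-∧-cover true  true  true  true  false true  _     = s≤s z≤n
χ-∧-cover true  true  true  true  false false cover with cover tt tt tt
... | inj₁ ()
... | inj₂ ()

d[d∸1]<4r⇒k*d<r : ∀ k d r → 4 * k < d → d * (d ∸ 1) < 4 * r → k * d < r
d[d∸1]<4r⇒k*d<r k (suc d) r 4k<1+d d[d-1]<4r = ≰⇒> (λ r≤kd → <⇒≱ (d<4k r≤kd) (≤-pred 4k<1+d))
  where
  d<4k : r ≤ k * suc d → d < 4 * k
  d<4k r≤kd = *-cancelˡ-< (suc d) d (4 * k) (begin-strict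
    suc d * d         <⟨ d[d-1]<4r ⟩
    4 * r             ≤⟨ *-monoʳ-≤ 4 r≤kd ⟩
    4 * (k * suc d)   ≡⟨ *-assoc 4 k (suc d) ⟨
    4 * k * suc d     ≡⟨ *-comm (4 * k) (suc d) ⟩
    suc d * (4 * k)   ∎)
    where open ≤-Reasoning

⊤─[p∪q]≡∁p─q : ∀ {n} (p q : Subset n) → ⊤ ─ (p ∪ q) ≡ ∁ p ─ q
⊤─[p∪q]≡∁p─q []            []            = refl
⊤─[p∪q]≡∁p─q (inside  ∷ p) (inside  ∷ q) = cong (outside ∷_) (⊤─[p∪q]≡∁p─q p q)
⊤─[p∪q]≡∁p─q (inside  ∷ p) (outside ∷ q) = cong (outside ∷_) (⊤─[p∪q]≡∁p─q p q)
⊤─[p∪q]≡∁p─q (outside ∷ p) (inside  ∷ q) = cong (outside ∷_) (⊤─[p∪q]≡∁p─q p q)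
⊤─[p∪q]≡∁p─q (outside ∷ p) (outside ∷ q) = cong (inside ∷_) (⊤─[p∪q]≡∁p─q p q)

q⊆p⇒∁q─[p─q]≡⊤─p : ∀ {n} {p q : Subset n} → q ⊆ p → ∁ q ─ (p ─ q) ≡ ⊤ ─ p
q⊆p⇒∁q─[p─q]≡⊤─p {p = []}          {[]}          _   = refl
q⊆p⇒∁q─[p─q]≡⊤─p {p = inside  ∷ p} {inside  ∷ q} q⊆p =
  cong (outside ∷_) (q⊆p⇒∁q─[p─q]≡⊤─p (drop-∷-⊆ q⊆p))
q⊆p⇒∁q─[p─q]≡⊤─p {p = outside ∷ p} {inside  ∷ q} q⊆p with () ← q⊆p here
q⊆p⇒∁q─[p─q]≡⊤─p {p = inside  ∷ p} {outside ∷ q} q⊆p =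
  cong (outside ∷_) (q⊆p⇒∁q─[p─q]≡⊤─p (drop-∷-⊆ q⊆p))
q⊆p⇒∁q─[p─q]≡⊤─p {p = outside ∷ p} {outside ∷ q} q⊆p =
  cong (inside ∷_) (q⊆p⇒∁q─[p─q]≡⊤─p (drop-∷-⊆ q⊆p))

x∉p⇒x∈⊤─p : ∀ {n} {x : Fin n} {p} → x ∉ p → x ∈ ⊤ ─ p
x∉p⇒x∈⊤─p = x∈p∧x∉q⇒x∈p─q ∈⊤

x∈p⇒⁅x⁆⊆p : ∀ {n} {x : Fin n} {p} → x ∈ p → ⁅ x ⁆ ⊆ p
x∈p⇒⁅x⁆⊆p {x = x} {p} x∈p y∈⁅x⁆ = subst (_∈ p) (sym (x∈⁅y⁆⇒x≡y x y∈⁅x⁆)) x∈p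

∣p∪q∣≤∣p∣+∣q∣ : ∀ {n} (p q : Subset n) → ∣ p ∪ q ∣ ≤ ∣ p ∣ + ∣ q ∣
∣p∪q∣≤∣p∣+∣q∣ []            []            = z≤n
∣p∪q∣≤∣p∣+∣q∣ (inside  ∷ p) (s       ∷ q) =
  s≤s (≤-trans (∣p∪q∣≤∣p∣+∣q∣ p q) (+-monoʳ-≤ ∣ p ∣ (∣p∣≤∣x∷p∣ s q)))
∣p∪q∣≤∣p∣+∣q∣ (outside ∷ p) (inside  ∷ q) =
  ≤-trans (s≤s (∣p∪q∣≤∣p∣+∣q∣ p q)) (≤-reflexive (sym (+-suc ∣ p ∣ ∣ q ∣)))
∣p∪q∣≤∣p∣+∣q∣ (outside ∷ p) (outside ∷ q) = ∣p∪q∣≤∣p∣+∣q∣ p q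

p─q⊆∁q : ∀ {n} (p q : Subset n) → p ─ q ⊆ ∁ q
p─q⊆∁q (inside  ∷ p) (outside ∷ q) here             = here
p─q⊆∁q (_       ∷ p) (_       ∷ q) (there x∈p─q)    = there (p─q⊆∁q p q x∈p─q)
p─q⊆∁q (outside ∷ p) (outside ∷ q) {zero} ()
p─q⊆∁q (_       ∷ p) (inside  ∷ q) {zero} ()

module _ {a p} {A : Set a} {P : Pred A p} (P? : Decidable P) where

  length≡length-filter+length-filter-∁ : ∀ xs →
    length xs ≡ length (filter P? xs) + length (filter (∁ᵘ? P?) xs)
  length≡length-filter+length-filter-∁ []       = refl
  length≡length-filter+length-filter-∁ (x ∷ xs) with P? x
  ... | yes _ = cong suc (length≡length-filter+length-filter-∁ xs)
  ... | no  _ = trans (cong suc (length≡length-filter+length-filter-∁ xs)) (sym (+-suc _ _))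

_∉?_ : ∀ {n} (x : Fin n) (p : Subset n) → Dec (x ∉ p)
x ∉? p = ¬? (x ∈? p)

Unique⇒length≤∣p∣ : ∀ {n} {xs : List (Fin n)} {p : Subset n} →
  Unique xs → All (_∈ p) xs → length xs ≤ ∣ p ∣
Unique⇒length≤∣p∣ []            []            = z≤n
Unique⇒length≤∣p∣ {xs = x ∷ xs} {p} (x≢xs ∷ uniq) (x∈p ∷ xs⊆p) =
  ≤-<-trans (Unique⇒length≤∣p∣ uniq xs⊆p-x) (x∈p⇒∣p-x∣<∣p∣ x∈p)
  where
  xs⊆p-x : All (_∈ p - x) xs
  xs⊆p-x = All.zipWith (λ (x≢y , y∈p) → x∈p∧x≢y⇒x∈p-y y∈p (≢-sym x≢y)) (x≢xs , xs⊆p)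

Unique⇒length≤∣p∣+length-filter-∉ : ∀ {n} {xs : List (Fin n)} (p : Subset n) → Unique xs →
  length xs ≤ ∣ p ∣ + length (filter (_∉? p) xs)
Unique⇒length≤∣p∣+length-filter-∉ {xs = xs} p uniq = begin
  length xs
    ≡⟨ length≡length-filter+length-filter-∁ (_∈? p) xs ⟩
  length (filter (_∈? p) xs) + length (filter (_∉? p) xs)
    ≤⟨ +-monoˡ-≤ _ in-p ⟩
  ∣ p ∣ + length (filter (_∉? p) xs)
    ∎
  where
  open ≤-Reasoning
  in-p : length (filter (_∈? p) xs) ≤ ∣ p ∣
  in-p = Unique⇒length≤∣p∣ (Unique-filter⁺ (_∈? p) uniq) (all-filter (_∈? p) xs)

module _ {n : ℕ} (G : Graph n) where

  Adj-sym : ∀ {a b} → Adj G a b → Adj G b a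
  Adj-sym {a} {b} = subst (0 <_) (symm G a b)

  Adj⇒≢ : ∀ {a b} → Adj G a b → a ≢ b
  Adj⇒≢ {a} a~a refl = <-irrefl refl (subst (0 <_) (loopless G a) a~a)

  T-adjᵇ⇒Adj : ∀ {a b} → T (adjᵇ G a b) → Adj G a b
  T-adjᵇ⇒Adj {a} {b} = <ᵇ⇒< 0 (mult G a b)

  triangle⇒CycleIn : ∀ {W u b c} → u ∈ W → b ∈ W → c ∈ W →
    Adj G u b → Adj G b c → Adj G c u → CycleIn G W u
  triangle⇒CycleIn {W} {u} {b} {c} u∈W b∈W c∈W u~b b~c c~u =
    0 , vertex , vertex-injective , vertex-in-comp , vertex-adjacent , c~u
    where
    vertex : Fin 3 → Fin n
    vertex zero             = u
    vertex (suc zero)       = b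
    vertex (suc (suc zero)) = c

    u≢b : u ≢ b
    u≢b = Adj⇒≢ u~b
    b≢c : b ≢ c
    b≢c = Adj⇒≢ b~c
    c≢u : c ≢ u
    c≢u = Adj⇒≢ c~u

    vertex-injective : ∀ {i j} → vertex i ≡ vertex j → i ≡ j
    vertex-injective {zero}           {zero}           _ = refl
    vertex-injective {suc zero}       {suc zero}       _ = refl
    vertex-injective {suc (suc zero)} {suc (suc zero)} _ = refl
    vertex-injective {zero}           {suc zero}       e = ⊥-elim (u≢b e)
    vertex-injective {zero}           {suc (suc zero)} e = ⊥-elim (c≢u (sym e))
    vertex-injective {suc zero}       {zero}           e = ⊥-elim (u≢b (sym e))
    vertex-injective {suc zero}       {suc (suc zero)} e = ⊥-elim (b≢c e)
    vertex-injective {suc (suc zero)} {zero}           e = ⊥-elim (c≢u e)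
    vertex-injective {suc (suc zero)} {suc zero}       e = ⊥-elim (b≢c (sym e))

    vertex-in-comp : ∀ i → InComp G W u (vertex i)
    vertex-in-comp zero             = here u∈W
    vertex-in-comp (suc zero)       = step u∈W u~b (here b∈W)
    vertex-in-comp (suc (suc zero)) = step u∈W (Adj-sym c~u) (here c∈W)

    vertex-adjacent : ∀ (i : Fin 2) → Adj G (vertex (inject₁ i)) (vertex (suc i))
    vertex-adjacent zero       = u~b
    vertex-adjacent (suc zero) = b~c

  IsCliqueComp⇒Adj : ∀ {W v a b} → v ∈ W → a ∈ W → b ∈ W → IsCliqueComp G W v →
    Adj G v a → Adj G v b → a ≢ b → Adj G a b
  IsCliqueComp⇒Adj v∈W a∈W b∈W clique v~a v~b a≢b =
    subst (0 <_) (sym (clique _ _ (step v∈W v~a (here a∈W)) (step v∈W v~b (here b∈W)) a≢b)) z<s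

  IsCliqueComp⇒Vtree-nbrs≤2 : ∀ {S X v} ws → v ∉ X → IsCliqueComp G (⊤ ─ X) v → Unique ws →
    All (λ w → Adj G v w × InVtree G S w) ws → All (_∉ X) ws → length ws ≤ 2
  IsCliqueComp⇒Vtree-nbrs≤2 []              _ _ _ _ _ = z≤n
  IsCliqueComp⇒Vtree-nbrs≤2 (_ ∷ [])        _ _ _ _ _ = s≤s z≤n
  IsCliqueComp⇒Vtree-nbrs≤2 (_ ∷ _ ∷ [])    _ _ _ _ _ = s≤s (s≤s z≤n)
  IsCliqueComp⇒Vtree-nbrs≤2 {X = X} {v} (a ∷ b ∷ c ∷ _) v∉X clique
    ((a≢b ∷ a≢c ∷ _) ∷ (b≢c ∷ _) ∷ _)
    ((v~a , a∉S , a-tree) ∷ (v~b , b∉S , _) ∷ (v~c , c∉S , _) ∷ _)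
    (a∉X ∷ b∉X ∷ c∉X ∷ _) =
    ⊥-elim (proj₂ a-tree (triangle⇒CycleIn (x∉p⇒x∈∁p a∉S) (x∉p⇒x∈∁p b∉S) (x∉p⇒x∈∁p c∉S)
                            (adj a∉X b∉X v~a v~b a≢b) (adj b∉X c∉X v~b v~c b≢c)
                            (Adj-sym (adj a∉X c∉X v~a v~c a≢c))))
    where
    adj : ∀ {x y} → x ∉ X → y ∉ X → Adj G v x → Adj G v y → x ≢ y → Adj G x y
    adj x∉X y∉X = IsCliqueComp⇒Adj (x∉p⇒x∈⊤─p v∉X) (x∉p⇒x∈⊤─p x∉X) (x∉p⇒x∈⊤─p y∉X) clique

  CoversNbrEdges : Fin n → Subset n → Set
  CoversNbrEdges v X = ∀ {a b} → Adj G v a → Adj G v b → Adj G a b → a ∈ X ⊎ b ∈ X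

  IsTreeComp⇒CoversNbrEdges : ∀ {X v} → v ∉ X → IsTreeComp G (⊤ ─ X) v → CoversNbrEdges v X
  IsTreeComp⇒CoversNbrEdges {X} v∉X tree {a} {b} v~a v~b a~b with a ∈? X | b ∈? X
  ... | yes a∈X | _       = inj₁ a∈X
  ... | no  _   | yes b∈X = inj₂ b∈X
  ... | no  a∉X | no  b∉X =
    ⊥-elim (proj₂ tree (triangle⇒CycleIn (x∉p⇒x∈⊤─p v∉X) (x∉p⇒x∈⊤─p a∉X) (x∉p⇒x∈⊤─p b∉X)
                                         v~a a~b (Adj-sym v~b)))

  -- An edge ab of G[N(v)] with a < b is charged to (x , y) ∈ X × N(v), where x is an endpoint of
  -- ab in X and y the other endpoint; the order a < b makes this charging injective.
  ρ≤∣X∣*∣Nbr∣ : ∀ {v X} → CoversNbrEdges v X → ρ G v ≤ ∣ X ∣ * ∣ Nbr G v ∣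
  ρ≤∣X∣*∣Nbr∣ {v} {X} cover = begin
    ρ G v
      ≡⟨ sumₗ-map-allFin² (λ a b → χ ((toℕ a <ᵇ toℕ b) ∧ adjᵇ G v a ∧ adjᵇ G v b ∧ adjᵇ G a b)) ⟩
    ∑[ a < n ] ∑[ b < n ] χ ((toℕ a <ᵇ toℕ b) ∧ adjᵇ G v a ∧ adjᵇ G v b ∧ adjᵇ G a b)
      ≤⟨ ∑-mono-≤ (λ a → ∑-mono-≤ (charge a)) ⟩
    ∑[ a < n ] ∑[ b < n ] (χ< a b * (h a b + h b a))
      ≤⟨ ∑∑-χ<-symmetrised≤∑∑ h ⟩
    ∑[ a < n ] ∑[ b < n ] h a b
      ≡⟨ ∑∑-*≡∑*∑ (χ ∘ lookup X) (χ ∘ adjᵇ G v) ⟩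
    ∑ (χ ∘ lookup X) * ∑ (χ ∘ adjᵇ G v)
      ≡⟨ cong₂ _*_ (∣p∣≡∑χ X) ∣Nbr∣≡∑χ ⟨
    ∣ X ∣ * ∣ Nbr G v ∣
      ∎
    where
    open ≤-Reasoning
    h : Fin n → Fin n → ℕ
    h a b = χ (lookup X a) * χ (adjᵇ G v b)
    ∈⇒T : ∀ {a} → a ∈ X → T (lookup X a)
    ∈⇒T a∈X = Equivalence.from T-≡ ([]=⇒lookup a∈X)
    charge : ∀ a b → χ ((toℕ a <ᵇ toℕ b) ∧ adjᵇ G v a ∧ adjᵇ G v b ∧ adjᵇ G a b)
                     ≤ χ< a b * (h a b + h b a)
    charge a b = χ-∧-cover (toℕ a <ᵇ toℕ b) (adjᵇ G v a) (adjᵇ G v b) (adjᵇ G a b)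
                           (lookup X a) (lookup X b)
      (λ v~a v~b a~b →
         Sum.map ∈⇒T ∈⇒T (cover (T-adjᵇ⇒Adj v~a) (T-adjᵇ⇒Adj v~b) (T-adjᵇ⇒Adj a~b)))
    ∣Nbr∣≡∑χ : ∣ Nbr G v ∣ ≡ ∑ (χ ∘ adjᵇ G v)
    ∣Nbr∣≡∑χ = trans (∣p∣≡∑χ (Nbr G v)) (sum-cong-≗ (cong χ ∘ lookup∘tabulate (adjᵇ G v)))

  InVld⇒k<∣cover∣ : ∀ {k v X} → InVld G k v → CoversNbrEdges v X → k < ∣ X ∣
  InVld⇒k<∣cover∣ {k} {v} {X} (7k<d , d[d-1]<4ρ) cover =
    *-cancelʳ-< d k ∣ X ∣
      (<-≤-trans (d[d∸1]<4r⇒k*d<r k d (ρ G v) 4k<d d[d-1]<4ρ) (ρ≤∣X∣*∣Nbr∣ cover))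
    where
    d : ℕ
    d = ∣ Nbr G v ∣
    4k<d : 4 * k < d
    4k<d = ≤-<-trans (*-monoˡ-≤ k (m≤m+n 4 3)) 7k<d

  InVld⇒∈solution : ∀ {k S v X} → InVld G k v → NbrsInVtreeAtLeast G S v (2 * k + 4) →
    ∣ X ∣ ≤ k → AllCliqueOrTree G (⊤ ─ X) → v ∈ X
  InVld⇒∈solution {k} {v = v} {X} vld (us , 2k+4≤∣us∣ , us-unique , us-nbrs) ∣X∣≤k solution
    with v ∈? X
  ... | yes v∈X = v∈X
  ... | no  v∉X with solution v (x∉p⇒x∈⊤─p v∉X)
  ...   | inj₂ tree   =
    ⊥-elim (<⇒≱ (InVld⇒k<∣cover∣ vld (IsTreeComp⇒CoversNbrEdges v∉X tree)) ∣X∣≤k)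
  ...   | inj₁ clique =
    ⊥-elim (<⇒≱ 3≤∣ws∣ (IsCliqueComp⇒Vtree-nbrs≤2 ws v∉X clique
                          (Unique-filter⁺ (_∉? X) us-unique)
                          (All-filter⁺ (_∉? X) us-nbrs) (all-filter (_∉? X) us)))
    where
    ws : List (Fin n)
    ws = filter (_∉? X) us
    3≤∣ws∣ : 3 ≤ length ws
    3≤∣ws∣ = +-cancelˡ-≤ ∣ X ∣ 3 (length ws) (begin
      ∣ X ∣ + 3         ≤⟨ +-monoˡ-≤ 3 ∣X∣≤k ⟩
      k + 3             ≤⟨ +-mono-≤ (m≤m+n k _) (n≤1+n 3) ⟩
      2 * k + 4         ≤⟨ 2k+4≤∣us∣ ⟩
      length us         ≤⟨ Unique⇒length≤∣p∣+length-filter-∉ X us-unique ⟩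
      ∣ X ∣ + length ws ∎)
      where open ≤-Reasoning

lemma23 : ∀ {n : ℕ} (G : Graph n) (k : ℕ) → 1 ≤ k →
    (S : Subset n) → AllCliqueOrTree G (∁ S) →
    (v : Fin n) → InVld G k v → v ∈ S →
    NbrsInVtreeAtLeast G S v (2 * k + 4) →
    YesInstance G ⊤ k ⇔ YesInstance G (∁ ⁅ v ⁆) (k ∸ 1)
lemma23 G (suc k) _ _ _ v vld _ nbrs = mk⇔ delete-v add-v
  where
  delete-v : YesInstance G ⊤ (suc k) → YesInstance G (∁ ⁅ v ⁆) k
  delete-v (X , _ , ∣X∣≤1+k , solution) =
    X - v , p─q⊆∁q X ⁅ v ⁆ , ≤-pred (<-≤-trans (x∈p⇒∣p-x∣<∣p∣ v∈X) ∣X∣≤1+k) ,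
    subst (AllCliqueOrTree G) (sym (q⊆p⇒∁q─[p─q]≡⊤─p (x∈p⇒⁅x⁆⊆p v∈X))) solution
    where
    v∈X : v ∈ X
    v∈X = InVld⇒∈solution G vld nbrs ∣X∣≤1+k solution

  add-v : YesInstance G (∁ ⁅ v ⁆) k → YesInstance G ⊤ (suc k)
  add-v (X , _ , ∣X∣≤k , solution) =
    ⁅ v ⁆ ∪ X , (λ _ → ∈⊤) ,
    ≤-trans (∣p∪q∣≤∣p∣+∣q∣ ⁅ v ⁆ X)
            (subst (λ m → m + ∣ X ∣ ≤ suc k) (sym (∣⁅x⁆∣≡1 v)) (s≤s ∣X∣≤k)) ,
    subst (AllCliqueOrTree G) (sym (⊤─[p∪q]≡∁p─q ⁅ v ⁆ X)) solution
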